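{- Let $X$ be a set of $n$ cards and let $a,b,c$ be positive integers with $a+b+c=n$ and $a>c$. If there exists an $(a,b,c)$-strategy with $m$ announcements that is informative for Bob, then $m \geq \binom{n-a+c}{c}$.
   Context: An $(a,b,c)$-deal partitions $X$ into Alice's hand $H_A$ ($a$ cards), Bob's hand $H_B$ ($b$ cards) and Cathy's hand $H_C$ ($c$ cards). $\binom{X}{t}$ denotes the set of $t$-subsets of $X$. An announcement is a subset of $\binom{X}{a}$. An $(a,b,c)$-strategy consists of announcements $\mathcal{A}_1,\dots,\mathcal{A}_m$ such that every $a$-subset of $X$ lies in at least one $\mathcal{A}_i$, together with, for each $H_A\in\binom{X}{a}$, a probability distribution $p_{H_A}$ on $g(H_A)=\{i : H_A\in\mathcal{A}_i\}$ with $p_{H_A}(i)>0$ for all $i\in g(H_A)$; holding $H_A$, Alice picks $i$ according to $p_{H_A}$ and publicly broadcasts $i$ (the strategy itself is public). For $H\subseteq X$ and an index $i$, $\mathcal{P}(H,i)=\{H_A\in\mathcal{A}_i : H_A\cap H=\emptyset\}$. The strategy is informative for Bob if $|\mathcal{P}(H_B,i)|\le 1$ for every $H_B\in\binom{X}{b}$ and every $i$. -}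

module Defs where

open import Data.Nat using (ℕ; zero; suc)
open import Data.Fin using (Fin; zero; suc)
open import Data.Fin.Subset using (Subset; ∣_∣; _∩_; ⊥)
open import Data.Bool using (Bool; true; false)
open import Data.Rational using (ℚ; 0ℚ; 1ℚ; _+_; _<_)
open import Data.Product using (∃)
open import Relation.Binary.PropositionalEquality using (_≡_)

-- The set of cards is X = Fin n; a subset of X is a 'Subset n'.

sumFin : (m : ℕ) → (Fin m → ℚ) → ℚ
sumFin zero    f = 0ℚ
sumFin (suc m) f = f zero + sumFin m (λ i → f (suc i))

Disjoint : {n : ℕ} → Subset n → Subset n → Set
Disjoint H H' = H ∩ H' ≡ ⊥

-- An (a,b,c)-strategy on X = Fin n with m announcements.
-- Announcement i is represented by its (decidable) characteristic
-- function  ann i : Subset n → Bool  on subsets of X.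
record Strategy (n a m : ℕ) : Set where
  field
    ann       : Fin m → Subset n → Bool
    annSize   : ∀ i H → ann i H ≡ true → ∣ H ∣ ≡ a
    cover     : ∀ H → ∣ H ∣ ≡ a → ∃ λ i → ann i H ≡ true
    prob      : Subset n → Fin m → ℚ
    probPos   : ∀ H → ∣ H ∣ ≡ a → ∀ i → ann i H ≡ true → 0ℚ < prob H i
    probZero  : ∀ H → ∣ H ∣ ≡ a → ∀ i → ann i H ≡ false → prob H i ≡ 0ℚ
    probSum   : ∀ H → ∣ H ∣ ≡ a → sumFin m (prob H) ≡ 1ℚ

open Strategy public

-- Informative for Bob: |P(H_B, i)| ≤ 1 for every b-subset H_B and every i,
-- where P(H_B,i) = { H_A ∈ A_i : H_A ∩ H_B = ∅ }.
InformativeForBob : {n a m : ℕ} → (b : ℕ) → Strategy n a m → Set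
InformativeForBob {n} b S =
  ∀ (HB : Subset n) → ∣ HB ∣ ≡ b → ∀ i (H₁ H₂ : Subset n) →
  ann S i H₁ ≡ true → Disjoint H₁ HB →
  ann S i H₂ ≡ true → Disjoint H₂ HB →
  H₁ ≡ H₂

-- Fix a set D of a − c cards. For every c-subset T of the remaining
-- n − a + c = b + 2c cards, Alice's hand D ∪ T is covered by some
-- announcement. Two different sets T, T' meet at most 2c cards, so some
-- b-set H_B of the remaining cards avoids both; if D ∪ T and D ∪ T' shared
-- an announcement i, both would lie in P(H_B, i), contradicting that the
-- strategy is informative for Bob. Hence T ↦ (announcement covering D ∪ T)
-- is injective, and m is at least the number of c-subsets of b + 2c cards.
module Submission where

open import Defs
open import Data.Nat using (ℕ; _+_; _∸_; _≤_; _<_)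
open import Data.Nat.Combinatorics using (_C_)
open import Relation.Binary.PropositionalEquality

open import Data.Nat using (zero; suc; z≤n; s≤s)
open import Data.Nat.Properties
  using (+-suc; +-comm; +-assoc; ≤-pred; ≤-trans; ≤-reflexive; +-monoʳ-≤; <⇒≤; m∸n+n≡m; m+n∸m≡n)
open import Data.Nat.Combinatorics using (nCk+nC[k+1]≡[n+1]C[k+1])
open import Data.Product using (Σ; _×_; _,_; proj₁; proj₂)
open import Data.Empty using (⊥-elim)
open import Data.Bool using (true)
open import Data.Bool.Properties using (∧-zeroʳ)
open import Relation.Nullary using (¬_)
open import Data.Fin using (Fin)
open import Data.Fin.Properties using (injective⇒≤)
open import Data.Fin.Subset using (Subset; inside; outside; ∣_∣; _∩_; _∪_; ⊥; ⊤)
open import Data.Fin.Subset.Properties using (∣⊥∣≡0; ∣p∣≤∣x∷p∣; ∩-zeroʳ)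
open import Data.Vec using ([]; _∷_; _++_)
open import Data.Vec.Properties using (∷-injectiveʳ; ++-injectiveʳ)
open import Data.List using (List; []; _∷_; map; length; lookup)
  renaming (_++_ to _++ˡ_)
open import Data.List.Properties using (length-map; length-++)
open import Data.List.Relation.Unary.All as All using (All; []; _∷_)
import Data.List.Relation.Unary.All.Properties as All
open import Data.List.Relation.Unary.AllPairs using ([]; _∷_)
open import Data.List.Relation.Unary.Unique.Propositional using (Unique)
import Data.List.Relation.Unary.Unique.Propositional.Properties as Unique
open import Data.List.Membership.Propositional using (_∈_)
open import Data.List.Membership.Propositional.Properties using (∈-map⁻; ∈-lookup)

lookup-injective : {A : Set} {xs : List A} → Unique xs →
  ∀ {i j} → lookup xs i ≡ lookup xs j → i ≡ j
lookup-injective (_ ∷ _) {Fin.zero} {Fin.zero} _ = refl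
lookup-injective (x∉xs ∷ _) {Fin.zero} {Fin.suc j} x≡xⱼ = ⊥-elim (All.lookup x∉xs (∈-lookup j) x≡xⱼ)
lookup-injective (x∉xs ∷ _) {Fin.suc i} {Fin.zero} xᵢ≡x = ⊥-elim (All.lookup x∉xs (∈-lookup i) (sym xᵢ≡x))
lookup-injective (_ ∷ xs!) {Fin.suc i} {Fin.suc j} xᵢ≡xⱼ = cong Fin.suc (lookup-injective xs! xᵢ≡xⱼ)

length≤-of-injective : {A : Set} {P : A → Set} {m : ℕ} {xs : List A} →
  Unique xs → All P xs → (f : ∀ x → P x → Fin m) →
  (∀ {x y} px py → f x px ≡ f y py → x ≡ y) → length xs ≤ m
length≤-of-injective {P = P} {xs = xs} xs! pxs f f-injective =
  injective⇒≤ (λ same → lookup-injective xs! (f-injective (p _) (p _) same))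
  where
  p : ∀ i → P (lookup xs i)
  p i = All.lookup pxs (∈-lookup {xs = xs} i)

combinations : (k c : ℕ) → List (Subset k)
combinations k       zero    = ⊥ ∷ []
combinations zero    (suc c) = []
combinations (suc k) (suc c) =
  map (outside ∷_) (combinations k (suc c)) ++ˡ map (inside ∷_) (combinations k c)

length-combinations : ∀ k c → length (combinations k c) ≡ k C c
length-combinations k       zero    = refl
length-combinations zero    (suc c) = refl
length-combinations (suc k) (suc c) = begin
  length (map (outside ∷_) (combinations k (suc c)) ++ˡ map (inside ∷_) (combinations k c))
    ≡⟨ length-++ (map (outside ∷_) (combinations k (suc c))) ⟩
  length (map (outside ∷_) (combinations k (suc c))) + length (map (inside ∷_) (combinations k c))
    ≡⟨ cong₂ _+_ (length-map _ (combinations k (suc c))) (length-map _ (combinations k c)) ⟩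
  length (combinations k (suc c)) + length (combinations k c)
    ≡⟨ cong₂ _+_ (length-combinations k (suc c)) (length-combinations k c) ⟩
  k C suc c + k C c
    ≡⟨ +-comm (k C suc c) (k C c) ⟩
  k C c + k C suc c
    ≡⟨ nCk+nC[k+1]≡[n+1]C[k+1] k c ⟩
  suc k C suc c ∎
  where open ≡-Reasoning

combinations-size : ∀ k c → All (λ p → ∣ p ∣ ≡ c) (combinations k c)
combinations-size k       zero    = ∣⊥∣≡0 k ∷ []
combinations-size zero    (suc c) = []
combinations-size (suc k) (suc c) = All.++⁺
  (All.map⁺ (combinations-size k (suc c)))
  (All.map⁺ (All.map (cong suc) (combinations-size k c)))

combinations-unique : ∀ k c → Unique (combinations k c)
combinations-unique k       zero    = [] ∷ []
combinations-unique zero    (suc c) = []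
combinations-unique (suc k) (suc c) = Unique.++⁺
  (Unique.map⁺ ∷-injectiveʳ (combinations-unique k (suc c)))
  (Unique.map⁺ ∷-injectiveʳ (combinations-unique k c))
  heads-differ
  where
  heads-differ : ∀ {p} → ¬ (p ∈ map (outside ∷_) (combinations k (suc c))
                          × p ∈ map (inside ∷_) (combinations k c))
  heads-differ (p∈outside , p∈inside) with ∈-map⁻ _ p∈outside | ∈-map⁻ _ p∈inside
  ... | _ , _ , refl | _ , _ , ()

∣p∪q∣≤∣p∣+∣q∣ : ∀ {k} (p q : Subset k) → ∣ p ∪ q ∣ ≤ ∣ p ∣ + ∣ q ∣
∣p∪q∣≤∣p∣+∣q∣ []            []            = z≤n
∣p∪q∣≤∣p∣+∣q∣ (inside  ∷ p) (y       ∷ q) =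
  s≤s (≤-trans (∣p∪q∣≤∣p∣+∣q∣ p q) (+-monoʳ-≤ ∣ p ∣ (∣p∣≤∣x∷p∣ y q)))
∣p∪q∣≤∣p∣+∣q∣ (outside ∷ p) (inside  ∷ q) =
  ≤-trans (s≤s (∣p∪q∣≤∣p∣+∣q∣ p q)) (≤-reflexive (sym (+-suc ∣ p ∣ ∣ q ∣)))
∣p∪q∣≤∣p∣+∣q∣ (outside ∷ p) (outside ∷ q) = ∣p∪q∣≤∣p∣+∣q∣ p q

m+[1+n]≤1+o⇒m+n≤o : ∀ m {n o} → m + suc n ≤ suc o → m + n ≤ o
m+[1+n]≤1+o⇒m+n≤o m {n} {o} h = ≤-pred (subst (_≤ suc o) (+-suc m n) h)

AvoidingSet : ∀ {k} → ℕ → Subset k → Subset k → Set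
AvoidingSet {k} b p q = Σ (Subset k) λ B → ∣ B ∣ ≡ b × Disjoint p B × Disjoint q B

outside∷-avoiding : ∀ {k b x y} {p q : Subset k} → AvoidingSet b p q → AvoidingSet b (x ∷ p) (y ∷ q)
outside∷-avoiding {x = x} {y} (B , ∣B∣≡b , p∩B≡⊥ , q∩B≡⊥) =
  outside ∷ B , ∣B∣≡b , cong₂ _∷_ (∧-zeroʳ x) p∩B≡⊥ , cong₂ _∷_ (∧-zeroʳ y) q∩B≡⊥

avoiding-set : ∀ {k} b (p q : Subset k) → b + ∣ p ∪ q ∣ ≤ k → AvoidingSet b p q
avoiding-set {k} zero p q _ = ⊥ , ∣⊥∣≡0 k , ∩-zeroʳ p , ∩-zeroʳ q
avoiding-set (suc b) (outside ∷ p) (outside ∷ q) h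
  with avoiding-set b p q (≤-pred h)
... | B , ∣B∣≡b , p∩B≡⊥ , q∩B≡⊥ =
  inside ∷ B , cong suc ∣B∣≡b , cong (outside ∷_) p∩B≡⊥ , cong (outside ∷_) q∩B≡⊥
avoiding-set (suc b) (inside ∷ p) (y ∷ q) h =
  outside∷-avoiding (avoiding-set (suc b) p q (m+[1+n]≤1+o⇒m+n≤o (suc b) h))
avoiding-set (suc b) (outside ∷ p) (inside ∷ q) h =
  outside∷-avoiding (avoiding-set (suc b) p q (m+[1+n]≤1+o⇒m+n≤o (suc b) h))

∣⊤++p∣≡d+∣p∣ : ∀ d {k} (p : Subset k) → ∣ ⊤ {d} ++ p ∣ ≡ d + ∣ p ∣
∣⊤++p∣≡d+∣p∣ zero    p = refl
∣⊤++p∣≡d+∣p∣ (suc d) p = cong suc (∣⊤++p∣≡d+∣p∣ d p)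

∣⊥++p∣≡∣p∣ : ∀ d {k} (p : Subset k) → ∣ ⊥ {d} ++ p ∣ ≡ ∣ p ∣
∣⊥++p∣≡∣p∣ zero    p = refl
∣⊥++p∣≡∣p∣ (suc d) p = ∣⊥++p∣≡∣p∣ d p

⊤++-disjoint-⊥++ : ∀ d {k} {p q : Subset k} → Disjoint p q → Disjoint (⊤ {d} ++ p) (⊥ {d} ++ q)
⊤++-disjoint-⊥++ zero    p∩q≡⊥ = p∩q≡⊥
⊤++-disjoint-⊥++ (suc d) p∩q≡⊥ = cong (outside ∷_) (⊤++-disjoint-⊥++ d p∩q≡⊥)

-- Alice's hands are ⊤ {d} ++ T: the first d cards play the role of D.
C≤announcements : ∀ d k {b c m} → b + (c + c) ≤ k →
  (S : Strategy (d + k) (d + c) m) → InformativeForBob b S → k C c ≤ m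
C≤announcements d k {b} {c} {m} b+2c≤k S informative =
  subst (_≤ m) (length-combinations k c)
    (length≤-of-injective (combinations-unique k c) (combinations-size k c)
      announcement announcement-injective)
  where
  hand : Subset k → Subset (d + k)
  hand T = ⊤ {d} ++ T

  hand-size : ∀ {T} → ∣ T ∣ ≡ c → ∣ hand T ∣ ≡ d + c
  hand-size {T} ∣T∣≡c = trans (∣⊤++p∣≡d+∣p∣ d T) (cong (d +_) ∣T∣≡c)

  announcement : ∀ T → ∣ T ∣ ≡ c → Fin m
  announcement T ∣T∣≡c = proj₁ (cover S (hand T) (hand-size ∣T∣≡c))

  announced : ∀ {T} (∣T∣≡c : ∣ T ∣ ≡ c) → ann S (announcement T ∣T∣≡c) (hand T) ≡ true
  announced {T} ∣T∣≡c = proj₂ (cover S (hand T) (hand-size ∣T∣≡c))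

  room : ∀ {T T'} → ∣ T ∣ ≡ c → ∣ T' ∣ ≡ c → b + ∣ T ∪ T' ∣ ≤ k
  room {T} {T'} ∣T∣≡c ∣T'∣≡c = ≤-trans
    (+-monoʳ-≤ b (subst (∣ T ∪ T' ∣ ≤_) (cong₂ _+_ ∣T∣≡c ∣T'∣≡c) (∣p∪q∣≤∣p∣+∣q∣ T T')))
    b+2c≤k

  announcement-injective : ∀ {T T'} ∣T∣≡c ∣T'∣≡c →
    announcement T ∣T∣≡c ≡ announcement T' ∣T'∣≡c → T ≡ T'
  announcement-injective {T} {T'} ∣T∣≡c ∣T'∣≡c same
    with avoiding-set b T T' (room {T} {T'} ∣T∣≡c ∣T'∣≡c)
  ... | B , ∣B∣≡b , T∩B≡⊥ , T'∩B≡⊥ =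
    ++-injectiveʳ ⊤ ⊤ (informative (⊥ {d} ++ B) (trans (∣⊥++p∣≡∣p∣ d B) ∣B∣≡b)
      (announcement T' ∣T'∣≡c) (hand T) (hand T')
      (subst (λ i → ann S i (hand T) ≡ true) same (announced ∣T∣≡c))
      (⊤++-disjoint-⊥++ d T∩B≡⊥)
      (announced ∣T'∣≡c)
      (⊤++-disjoint-⊥++ d T'∩B≡⊥))

theorem2 : (n a b c m : ℕ) → 0 < a → 0 < b → 0 < c → a + b + c ≡ n → c < a →
    (S : Strategy n a m) → InformativeForBob b S →
    (n ∸ a + c) C c ≤ m
theorem2 n a b c m _ _ _ a+b+c≡n c<a = reindex n≡d+k a≡d+c
  where
  open ≡-Reasoning

  d k : ℕ
  d = a ∸ c
  k = n ∸ a + c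

  a≡d+c : a ≡ d + c
  a≡d+c = sym (m∸n+n≡m (<⇒≤ c<a))

  n∸a≡b+c : n ∸ a ≡ b + c
  n∸a≡b+c = begin
    n ∸ a           ≡⟨ cong (_∸ a) (trans (sym a+b+c≡n) (+-assoc a b c)) ⟩
    a + (b + c) ∸ a ≡⟨ m+n∸m≡n a (b + c) ⟩
    b + c           ∎

  n≡d+k : n ≡ d + k
  n≡d+k = begin
    n                 ≡⟨ trans (sym a+b+c≡n) (+-assoc a b c) ⟩
    a + (b + c)       ≡⟨ cong₂ _+_ a≡d+c (sym n∸a≡b+c) ⟩
    d + c + (n ∸ a)   ≡⟨ +-assoc d c (n ∸ a) ⟩
    d + (c + (n ∸ a)) ≡⟨ cong (d +_) (+-comm c (n ∸ a)) ⟩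
    d + k             ∎

  b+2c≤k : b + (c + c) ≤ k
  b+2c≤k = ≤-reflexive (trans (sym (+-assoc b c c)) (cong (_+ c) (sym n∸a≡b+c)))

  reindex : ∀ {n′ a′} → n′ ≡ d + k → a′ ≡ d + c →
    (S : Strategy n′ a′ m) → InformativeForBob b S → k C c ≤ m
  reindex refl refl = C≤announcements d k b+2c≤k
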